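{- Let $m\ge 2$ be an integer and let $H$ be a connected graph of order at least $2$ without a universal vertex. (i) If $\operatorname{diam}(H)=2$, then $\mathrm{gp}_{\rm o}(K_m\circ H)=\mathrm{gp}_{\rm o}(H)$. (ii) If $\operatorname{diam}(H)>2$, then $\mathrm{gp}_{\rm o}(K_m\circ H)=\mathrm{gp}_{\rm o}(K_1+H)$.
   Context: All graphs are finite and simple, and (as a standing assumption of the paper) connected. For $X\subseteq V(G)$, two vertices $u,v$ are $X$-positionable if no shortest $u,v$-path has an internal vertex in $X$. $X$ is an outer general position set if every two vertices of $X$ are $X$-positionable and every $u\in X$, $v\in V(G)\setminus X$ are $X$-positionable; $\mathrm{gp}_{\rm o}$ is the maximum cardinality of such a set. A universal vertex is adjacent to all other vertices. $K_1+H$ is the join of $K_1$ with $H$. The lexicographic product $G\circ H$ has vertex set $V(G)\times V(H)$, with $(g,h)$ and $(g',h')$ adjacent iff either $gg'\in E(G)$, or $g=g'$ and $hh'\in E(H)$. -}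

module Defs where

open import Data.Nat using (ℕ; zero; suc; _≤_; _<_; _*_)
open import Data.Fin using (Fin; zero; suc; remQuot; _≟_)
open import Data.Fin.Subset using (Subset; _∈_; _∉_; ∣_∣)
open import Data.Bool using (Bool; true; false; _∧_; _∨_; not)
open import Data.Product using (Σ; ∃; ∃-syntax; _×_; _,_; proj₁; proj₂)
open import Data.Sum using (_⊎_)
open import Relation.Nullary using (¬_)
open import Relation.Nullary.Decidable using (⌊_⌋)
open import Relation.Binary.PropositionalEquality using (_≡_)

record Graph : Set where
  constructor mkGraph
  field
    order : ℕ
    adj   : Fin order → Fin order → Bool
open Graph public

V : Graph → Set
V G = Fin (order G)

Adj : (G : Graph) → V G → V G → Set
Adj G u v = adj G u v ≡ true

IsSimple : Graph → Set
IsSimple G = (∀ u v → adj G u v ≡ adj G v u) × (∀ u → adj G u u ≡ false)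

data Walk (G : Graph) : V G → V G → ℕ → Set where
  here : ∀ {u} → Walk G u u 0
  step : ∀ {u w v k} → Adj G u w → Walk G w v k → Walk G u v (suc k)

-- internal vertices of a walk (all vertices except the first and last positions)
data Inner {G : Graph} : ∀ {u v k} → Walk G u v k → V G → Set where
  inner-here  : ∀ {u w x v k} (a : Adj G u w) (b : Adj G w x) (p : Walk G x v k) →
                Inner (step a (step b p)) w
  inner-there : ∀ {u w v k y} (a : Adj G u w) (p : Walk G w v k) →
                Inner p y → Inner (step a p) y

-- a shortest u,v-path: a u,v-walk of minimum length (such walks are paths)
IsShortest : {G : Graph} {u v : V G} {k : ℕ} → Walk G u v k → Set
IsShortest {G} {u} {v} {k} p = ∀ k' → Walk G u v k' → k ≤ k'

Connected : Graph → Set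
Connected G = ∀ u v → ∃[ k ] Walk G u v k

Dist : (G : Graph) → V G → V G → ℕ → Set
Dist G u v k = Σ (Walk G u v k) IsShortest

Diam : Graph → ℕ → Set
Diam G d = (∃[ u ] ∃[ v ] Dist G u v d) × (∀ u v k → Dist G u v k → k ≤ d)

Universal : (G : Graph) → V G → Set
Universal G u = ∀ v → ¬ (v ≡ u) → Adj G u v

NoUniversal : Graph → Set
NoUniversal G = ∀ u → ¬ Universal G u

Positionable : (G : Graph) → Subset (order G) → V G → V G → Set
Positionable G X u v =
  ∀ k (p : Walk G u v k) → IsShortest p → ∀ x → Inner p x → x ∉ X

IsOuterGP : (G : Graph) → Subset (order G) → Set
IsOuterGP G X =
  (∀ u v → u ∈ X → v ∈ X → Positionable G X u v) ×
  (∀ u v → u ∈ X → v ∉ X → Positionable G X u v)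

IsGpo : Graph → ℕ → Set
IsGpo G k =
  (∃[ X ] IsOuterGP G X × ∣ X ∣ ≡ k) × (∀ X → IsOuterGP G X → ∣ X ∣ ≤ k)

SameGpo : Graph → Graph → Set
SameGpo G G' = ∃[ k ] IsGpo G k × IsGpo G' k

K : ℕ → Graph
K m = mkGraph m (λ i j → not ⌊ i ≟ j ⌋)

K1+ : Graph → Graph
K1+ H = mkGraph (suc (order H)) a
  where
  a : Fin (suc (order H)) → Fin (suc (order H)) → Bool
  a zero    zero    = false
  a zero    (suc j) = true
  a (suc i) zero    = true
  a (suc i) (suc j) = adj H i j

-- lexicographic product G ∘ H ; vertex (g,h) encoded via remQuot / combine
_∘ₗ_ : Graph → Graph → Graph
G ∘ₗ H = mkGraph (order G * order H) a
  where
  a : Fin (order G * order H) → Fin (order G * order H) → Bool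
  a i j with remQuot {order G} (order H) i | remQuot {order G} (order H) j
  ... | (g , h) | (g' , h') = adj G g g' ∨ (⌊ g ≟ g' ⌋ ∧ adj H h h')

-- In a graph of diameter at most 2, a set X is in outer general position iff no induced
-- path u – x – v has u, x ∈ X; call such sets P₃-avoiding.  Both Kₘ ∘ H (m ≥ 2) and
-- K₁ + H have diameter 2, and when H has no universal vertex their P₃-avoiding sets
-- correspond to those of H without loss of size: in Kₘ ∘ H such a set lies in a single
-- copy of H, and in K₁ + H a set containing the apex is just the apex.  So all three
-- outer general position numbers equal the largest size of a P₃-avoiding set of H,
-- which is gp_o(H) itself when diam H = 2.
module Submission where

open import Defs
open import Data.Nat using (ℕ; _≤_; _<_)
open import Data.Product using (_×_)

open import Data.Nat using (zero; suc; _+_; _*_; z≤n; s≤s)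
open import Data.Nat.Properties
  using (≤-trans; ≤-refl; ≤-reflexive; ≤-antisym; ≤-total; ≮⇒≥; n≤1+n; +-identityʳ; anyUpTo?)
open import Data.Nat.Induction using (<-rec)
open import Data.Product using (∃-syntax; _,_; proj₁; proj₂)
open import Data.Sum using (_⊎_; inj₁; inj₂)
open import Data.Empty using (⊥-elim)
open import Data.Bool using (true; false; _∧_; _∨_; not)
open import Data.Bool.Properties using () renaming (_≟_ to _≟ᵇ_)
open import Data.Fin using (Fin; zero; suc; combine; fromℕ<)
open import Data.Fin.Properties
  using (any?; all?; ¬∀⟶∃¬; suc-injective; remQuot-combine; combine-surjective; combine-injectiveʳ)
open import Data.Fin.Subset using (Subset; _∈_; _∉_; _⊆_; ∣_∣; ⁅_⁆)
open import Data.Fin.Subset.Properties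
  using (_∈?_; ∉⊥; ∣⊥∣≡0; ∣⁅x⁆∣≡1; x∈⁅y⁆⇒x≡y; Empty-unique; p⊆q⇒∣p∣≤∣q∣)
open import Data.Vec using ([]; _∷_; _++_; lookup; tabulate; here; there)
open import Data.Vec.Properties
  using ([]=⇒lookup; lookup⇒[]=; lookup-++ˡ; lookup-++ʳ; lookup-replicate; lookup∘tabulate)
open import Function using (_∘_)
open import Relation.Nullary using (¬_; Dec; yes; no; contradiction)
open import Relation.Nullary.Decidable using (⌊_⌋; _×-dec_; _→-dec_; ¬?)
open import Relation.Binary.PropositionalEquality

import Data.Fin as Fin
import Data.Fin.Subset as Subset

walk-0⇒≡ : ∀ {G u v} → Walk G u v 0 → u ≡ v
walk-0⇒≡ here = refl

walk-1⇒Adj : ∀ {G u v} → Walk G u v 1 → Adj G u v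
walk-1⇒Adj (step a here) = a

Inner⇒2≤length : ∀ {G u v k x} {p : Walk G u v k} → Inner p x → 2 ≤ k
Inner⇒2≤length (inner-here a b p)  = s≤s (s≤s z≤n)
Inner⇒2≤length (inner-there a p i) = ≤-trans (Inner⇒2≤length i) (n≤1+n _)

Inner-length≤2 : ∀ {G u v k x} {p : Walk G u v k} → Inner p x → k ≤ 2 → Adj G u x × Adj G x v
Inner-length≤2 (inner-here a b here)       _              = a , b
Inner-length≤2 (inner-here a b (step _ _)) (s≤s (s≤s ()))
Inner-length≤2 (inner-there a p i)         (s≤s k≤1)
  with ≤-trans (Inner⇒2≤length i) k≤1
... | s≤s ()

walk? : ∀ G k u v → Dec (Walk G u v k)
walk? G zero u v with u Fin.≟ v
... | yes refl = yes here
... | no u≢v   = no (λ p → u≢v (walk-0⇒≡ p))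
walk? G (suc k) u v with any? (λ w → (adj G u w ≟ᵇ true) ×-dec walk? G k w v)
... | yes (w , a , p) = yes (step a p)
... | no ¬step        = no λ { (step a p) → ¬step (_ , a , p) }

shortest-walk : ∀ {G u v} k → Walk G u v k → ∃[ j ] Dist G u v j
shortest-walk {G} {u} {v} = <-rec _ shorten
  where
  shorten : ∀ k → (∀ {j} → j < k → Walk G u v j → ∃[ i ] Dist G u v i) →
            Walk G u v k → ∃[ i ] Dist G u v i
  shorten k rec p with anyUpTo? (λ j → walk? G j u v) k
  ... | yes (j , j<k , q) = rec j<k q
  ... | no none           = k , p , λ j q → ≮⇒≥ (λ j<k → none (j , j<k , q))

DiameterAtMost2 : Graph → Set
DiameterAtMost2 G = ∀ u v → ∃[ j ] (j ≤ 2 × Walk G u v j)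

Diam2⇒DiameterAtMost2 : ∀ G → Connected G → Diam G 2 → DiameterAtMost2 G
Diam2⇒DiameterAtMost2 G connected (_ , diam≤2) u v
  with shortest-walk _ (proj₂ (connected u v))
... | j , p , p-shortest = j , diam≤2 u v j (p , p-shortest) , p

non-neighbour : ∀ H → NoUniversal H → ∀ h → ∃[ k ] (¬ k ≡ h × ¬ Adj H h k)
non-neighbour H no-universal h
  with ¬∀⟶∃¬ (order H) (λ k → ¬ k ≡ h → Adj H h k)
             (λ k → ¬? (k Fin.≟ h) →-dec (adj H h k ≟ᵇ true)) (no-universal h)
... | k , ¬[k≢h⇒hk] with k Fin.≟ h
... | yes k≡h = ⊥-elim (¬[k≢h⇒hk] λ k≢h → ⊥-elim (k≢h k≡h))
... | no  k≢h = k , k≢h , λ hk → ¬[k≢h⇒hk] λ _ → hk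

InducedP₃ : (G : Graph) → V G → V G → V G → Set
InducedP₃ G u x v = Adj G u x × Adj G x v × ¬ u ≡ v × ¬ Adj G u v

P₃-Avoiding : (G : Graph) → Subset (order G) → Set
P₃-Avoiding G X = ∀ u x v → u ∈ X → x ∈ X → ¬ InducedP₃ G u x v

P₃-avoiding? : ∀ G X → Dec (P₃-Avoiding G X)
P₃-avoiding? G X = all? λ u → all? λ x → all? λ v →
  (u ∈? X) →-dec (x ∈? X) →-dec ¬?
    ((adj G u x ≟ᵇ true) ×-dec (adj G x v ≟ᵇ true) ×-dec ¬? (u Fin.≟ v) ×-dec ¬? (adj G u v ≟ᵇ true))

∅-P₃-avoiding : ∀ G → P₃-Avoiding G Subset.⊥
∅-P₃-avoiding G u x v u∈∅ = contradiction u∈∅ ∉⊥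

P₃-shortest : ∀ G {u x v} (ux : Adj G u x) (xv : Adj G x v) → ¬ u ≡ v → ¬ Adj G u v →
              IsShortest (step ux (step xv here))
P₃-shortest G ux xv u≢v _   zero          q = ⊥-elim (u≢v (walk-0⇒≡ q))
P₃-shortest G ux xv _   ¬uv (suc zero)    q = ⊥-elim (¬uv (walk-1⇒Adj {G} q))
P₃-shortest G ux xv _   _   (suc (suc k)) _ = s≤s (s≤s z≤n)

outerGP⇒P₃-avoiding : ∀ G X → IsOuterGP G X → P₃-Avoiding G X
outerGP⇒P₃-avoiding G X (inside-pairs , mixed-pairs) u x v u∈X x∈X (ux , xv , u≢v , ¬uv) =
  positionable 2 (step ux (step xv here)) (P₃-shortest G ux xv u≢v ¬uv) x (inner-here ux xv here) x∈X
  where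
  positionable : Positionable G X u v
  positionable with v ∈? X
  ... | yes v∈X = inside-pairs u v u∈X v∈X
  ... | no  v∉X = mixed-pairs u v u∈X v∉X

-- In diameter at most 2 a shortest path with an inner vertex has length exactly 2.
P₃-avoiding⇒positionable : ∀ G X → DiameterAtMost2 G → P₃-Avoiding G X →
                           ∀ u v → u ∈ X → Positionable G X u v
P₃-avoiding⇒positionable G X diam avoiding u v u∈X k p p-shortest x inner x∈X
  with diam u v
... | j , j≤2 , q with Inner-length≤2 inner (≤-trans (p-shortest j q) j≤2)
... | ux , xv = avoiding u x v u∈X x∈X (ux , xv , u≢v , ¬uv)
  where
  2≤k : 2 ≤ k
  2≤k = Inner⇒2≤length inner
  u≢v : ¬ u ≡ v
  u≢v refl with ≤-trans 2≤k (p-shortest 0 here)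
  ... | ()
  ¬uv : ¬ Adj G u v
  ¬uv uv with ≤-trans 2≤k (p-shortest 1 (step uv here))
  ... | s≤s ()

P₃-avoiding⇒outerGP : ∀ G X → DiameterAtMost2 G → P₃-Avoiding G X → IsOuterGP G X
P₃-avoiding⇒outerGP G X diam avoiding =
  (λ u v u∈X _ → P₃-avoiding⇒positionable G X diam avoiding u v u∈X) ,
  (λ u v u∈X _ → P₃-avoiding⇒positionable G X diam avoiding u v u∈X)

MaxOf : ∀ {n} → (Subset n → Set) → ℕ → Set
MaxOf P k = (∃[ X ] (P X × ∣ X ∣ ≡ k)) × (∀ X → P X → ∣ X ∣ ≤ k)

maxOf-or-none : ∀ n (P : Subset n → Set) → (∀ X → Dec (P X)) → (∀ X → ¬ P X) ⊎ ∃[ k ] MaxOf P k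
maxOf-or-none zero P P? with P? []
... | yes p = inj₂ (0 , ([] , p , refl) , λ { [] _ → z≤n })
... | no ¬p = inj₁ λ { [] → ¬p }
maxOf-or-none (suc n) P P?
  with maxOf-or-none n (λ X → P (true ∷ X)) (λ X → P? (true ∷ X))
     | maxOf-or-none n (λ X → P (false ∷ X)) (λ X → P? (false ∷ X))
... | inj₁ none₁ | inj₁ none₀ = inj₁ λ { (true ∷ X) → none₁ X ; (false ∷ X) → none₀ X }
... | inj₂ (k₁ , (X₁ , p₁ , e₁) , max₁) | inj₁ none₀ =
  inj₂ (suc k₁ , (true ∷ X₁ , p₁ , cong suc e₁) ,
        λ { (true ∷ X) p → s≤s (max₁ X p) ; (false ∷ X) p → ⊥-elim (none₀ X p) })
... | inj₁ none₁ | inj₂ (k₀ , (X₀ , p₀ , e₀) , max₀) =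
  inj₂ (k₀ , (false ∷ X₀ , p₀ , e₀) ,
        λ { (true ∷ X) p → ⊥-elim (none₁ X p) ; (false ∷ X) p → max₀ X p })
... | inj₂ (k₁ , (X₁ , p₁ , e₁) , max₁) | inj₂ (k₀ , (X₀ , p₀ , e₀) , max₀) with ≤-total (suc k₁) k₀
... | inj₁ k₁<k₀ = inj₂ (k₀ , (false ∷ X₀ , p₀ , e₀) ,
        λ { (true ∷ X) p → ≤-trans (s≤s (max₁ X p)) k₁<k₀ ; (false ∷ X) p → max₀ X p })
... | inj₂ k₀≤k₁ = inj₂ (suc k₁ , (true ∷ X₁ , p₁ , cong suc e₁) ,
        λ { (true ∷ X) p → s≤s (max₁ X p) ; (false ∷ X) p → ≤-trans (max₀ X p) k₀≤k₁ })

maxOf-P₃-avoiding : ∀ G → ∃[ k ] MaxOf (P₃-Avoiding G) k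
maxOf-P₃-avoiding G with maxOf-or-none (order G) (P₃-Avoiding G) (P₃-avoiding? G)
... | inj₁ none = ⊥-elim (none Subset.⊥ (∅-P₃-avoiding G))
... | inj₂ max  = max

_≼_ : ∀ {m n} → (Subset m → Set) → (Subset n → Set) → Set
P ≼ Q = ∀ X → P X → ∃[ Y ] (Q Y × ∣ X ∣ ≤ ∣ Y ∣)

MaxOf-transfer : ∀ {m n} {P : Subset m → Set} {Q : Subset n → Set} {k} →
                 P ≼ Q → Q ≼ P → MaxOf P k → MaxOf Q k
MaxOf-transfer {Q = Q} {k} P≼Q Q≼P ((X , pX , ∣X∣≡k) , maxP) with P≼Q X pX
... | Y , qY , ∣X∣≤∣Y∣ = (Y , qY , ≤-antisym (maxQ Y qY) (subst (_≤ ∣ Y ∣) ∣X∣≡k ∣X∣≤∣Y∣)) , maxQ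
  where
  maxQ : ∀ Z → Q Z → ∣ Z ∣ ≤ k
  maxQ Z qZ with Q≼P Z qZ
  ... | W , pW , ∣Z∣≤∣W∣ = ≤-trans ∣Z∣≤∣W∣ (maxP W pW)

gpo-from-P₃-avoiding : ∀ G {k} → DiameterAtMost2 G → MaxOf (P₃-Avoiding G) k → IsGpo G k
gpo-from-P₃-avoiding G diam =
  MaxOf-transfer (λ X avoiding → X , P₃-avoiding⇒outerGP G X diam avoiding , ≤-refl)
                 (λ X gp → X , outerGP⇒P₃-avoiding G X gp , ≤-refl)

K1+-diameterAtMost2 : ∀ H → DiameterAtMost2 (K1+ H)
K1+-diameterAtMost2 H zero    zero    = 0 , z≤n , here
K1+-diameterAtMost2 H zero    (suc j) = 1 , s≤s z≤n , step refl here
K1+-diameterAtMost2 H (suc i) zero    = 1 , s≤s z≤n , step refl here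
K1+-diameterAtMost2 H (suc i) (suc j) = 2 , ≤-refl , step {w = zero} refl (step refl here)

P₃-avoiding-K1+ : ∀ H Y → P₃-Avoiding H Y → P₃-Avoiding (K1+ H) (false ∷ Y)
P₃-avoiding-K1+ H Y avoiding (suc h) (suc y) zero    _ _ (_ , _ , _ , ¬h0) = ¬h0 refl
P₃-avoiding-K1+ H Y avoiding (suc h) (suc y) (suc k) (there h∈Y) (there y∈Y) (hy , yk , h≢k , ¬hk) =
  avoiding h y k h∈Y y∈Y (hy , yk , (λ h≡k → h≢k (cong suc h≡k)) , ¬hk)

P₃-avoiding-K1+⁻ : ∀ H X → P₃-Avoiding (K1+ H) (false ∷ X) → P₃-Avoiding H X
P₃-avoiding-K1+⁻ H X avoiding h y k h∈X y∈X (hy , yk , h≢k , ¬hk) =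
  avoiding (suc h) (suc y) (suc k) (there h∈X) (there y∈X) (hy , yk , (λ e → h≢k (suc-injective e)) , ¬hk)

-- If the apex lies in a P₃-avoiding set, every other vertex h of it yields the
-- induced path h – apex – k for a non-neighbour k of h.
apex-alone : ∀ H → NoUniversal H → ∀ X → P₃-Avoiding (K1+ H) (true ∷ X) → ∀ h → h ∉ X
apex-alone H no-universal X avoiding h h∈X with non-neighbour H no-universal h
... | k , k≢h , ¬hk =
  avoiding (suc h) zero (suc k) (there h∈X) here (refl , refl , (λ e → k≢h (sym (suc-injective e))) , ¬hk)

singleton-P₃-avoiding : ∀ G → (∀ u → adj G u u ≡ false) → ∀ u → P₃-Avoiding G ⁅ u ⁆
singleton-P₃-avoiding G loopless w u x v u∈⁅w⁆ x∈⁅w⁆ (ux , _)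
  with x∈⁅y⁆⇒x≡y w u∈⁅w⁆ | x∈⁅y⁆⇒x≡y w x∈⁅w⁆
... | refl | refl with () ← trans (sym ux) (loopless w)

H≼K1+H : ∀ H → P₃-Avoiding H ≼ P₃-Avoiding (K1+ H)
H≼K1+H H Y avoiding = false ∷ Y , P₃-avoiding-K1+ H Y avoiding , ≤-refl

K1+H≼H : ∀ H → (∀ u → adj H u u ≡ false) → NoUniversal H → 2 ≤ order H →
         P₃-Avoiding (K1+ H) ≼ P₃-Avoiding H
K1+H≼H H loopless no-universal 2≤n (false ∷ X) avoiding = X , P₃-avoiding-K1+⁻ H X avoiding , ≤-refl
K1+H≼H H loopless no-universal 2≤n (true ∷ X) avoiding =
  ⁅ h ⁆ , singleton-P₃-avoiding H loopless h , ≤-reflexive (begin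
    suc ∣ X ∣                  ≡⟨ cong (suc ∘ ∣_∣) (Empty-unique X-empty) ⟩
    suc ∣ Subset.⊥ {order H} ∣ ≡⟨ cong suc (∣⊥∣≡0 (order H)) ⟩
    1                          ≡⟨ sym (∣⁅x⁆∣≡1 h) ⟩
    ∣ ⁅ h ⁆ ∣                  ∎)
  where
  open ≡-Reasoning
  h : V H
  h = fromℕ< 2≤n
  X-empty : Subset.Empty X
  X-empty (x , x∈X) = apex-alone H no-universal X avoiding x x∈X

∣++∣ : ∀ {i j} (xs : Subset i) (ys : Subset j) → ∣ xs ++ ys ∣ ≡ ∣ xs ∣ + ∣ ys ∣
∣++∣ []           ys = refl
∣++∣ (true ∷ xs)  ys = cong suc (∣++∣ xs ys)
∣++∣ (false ∷ xs) ys = ∣++∣ xs ys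

module Lexicographic (H : Graph) where

  private variable m : ℕ

  adj-combine : ∀ (a b : Fin m) h k →
    adj (K m ∘ₗ H) (combine a h) (combine b k) ≡ (not ⌊ a Fin.≟ b ⌋ ∨ (⌊ a Fin.≟ b ⌋ ∧ adj H h k))
  adj-combine {m} a b h k
    rewrite cong proj₁ (remQuot-combine {m} {order H} a h) | cong proj₂ (remQuot-combine {m} {order H} a h)
          | cong proj₁ (remQuot-combine {m} {order H} b k) | cong proj₂ (remQuot-combine {m} {order H} b k) = refl

  adj-same-layer : ∀ (a : Fin m) h k → adj (K m ∘ₗ H) (combine a h) (combine a k) ≡ adj H h k
  adj-same-layer a h k rewrite adj-combine a a h k with a Fin.≟ a
  ... | yes _  = refl
  ... | no a≢a = ⊥-elim (a≢a refl)

  Adj-different-layers : ∀ {a b : Fin m} h k → ¬ a ≡ b → Adj (K m ∘ₗ H) (combine a h) (combine b k)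
  Adj-different-layers {a = a} {b} h k a≢b rewrite adj-combine a b h k with a Fin.≟ b
  ... | yes a≡b = ⊥-elim (a≢b a≡b)
  ... | no  _   = refl

  InducedP₃-in-layer : ∀ (a : Fin m) {h y k} → InducedP₃ H h y k →
                       InducedP₃ (K m ∘ₗ H) (combine a h) (combine a y) (combine a k)
  InducedP₃-in-layer a {h} {y} {k} (hy , yk , h≢k , ¬hk) =
    trans (adj-same-layer a h y) hy , trans (adj-same-layer a y k) yk ,
    (λ e → h≢k (combine-injectiveʳ a h a k e)) , (λ hk → ¬hk (trans (sym (adj-same-layer a h k)) hk))

  InducedP₃-in-layer⁻ : ∀ (a : Fin m) {h y k} → InducedP₃ (K m ∘ₗ H) (combine a h) (combine a y) (combine a k) →
                        InducedP₃ H h y k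
  InducedP₃-in-layer⁻ a {h} {y} {k} (hy , yk , h≢k , ¬hk) =
    trans (sym (adj-same-layer a h y)) hy , trans (sym (adj-same-layer a y k)) yk ,
    (λ e → h≢k (cong (combine a) e)) , (λ hk → ¬hk (trans (adj-same-layer a h k) hk))

  another : (a : Fin (suc (suc m))) → ∃[ b ] ¬ b ≡ a
  another zero    = suc zero , λ ()
  another (suc _) = zero , λ ()

  K∘-diameterAtMost2 : DiameterAtMost2 (K (suc (suc m)) ∘ₗ H)
  K∘-diameterAtMost2 {m} u v
    with combine-surjective {suc (suc m)} {order H} u | combine-surjective {suc (suc m)} {order H} v
  ... | a , h , refl | b , k , refl with a Fin.≟ b
  ... | no a≢b   = 1 , s≤s z≤n , step (Adj-different-layers h k a≢b) here
  ... | yes refl with another a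
  ... | c , c≢a  = 2 , ≤-refl ,
    step (Adj-different-layers h h (λ a≡c → c≢a (sym a≡c))) (step (Adj-different-layers h k c≢a) here)

  layer : Fin m → Subset (order H) → Subset (m * order H)
  layer {suc m} zero    Y = Y ++ Subset.⊥
  layer {suc m} (suc a) Y = Subset.⊥ ++ layer a Y

  ∣layer∣ : ∀ (a : Fin m) Y → ∣ layer a Y ∣ ≡ ∣ Y ∣
  ∣layer∣ {suc m} zero Y = begin
    ∣ Y ++ Subset.⊥ {m * order H} ∣    ≡⟨ ∣++∣ Y Subset.⊥ ⟩
    ∣ Y ∣ + ∣ Subset.⊥ {m * order H} ∣ ≡⟨ cong (∣ Y ∣ +_) (∣⊥∣≡0 (m * order H)) ⟩
    ∣ Y ∣ + 0                          ≡⟨ +-identityʳ ∣ Y ∣ ⟩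
    ∣ Y ∣                              ∎
    where open ≡-Reasoning
  ∣layer∣ {suc m} (suc a) Y = begin
    ∣ Subset.⊥ {order H} ++ layer a Y ∣    ≡⟨ ∣++∣ (Subset.⊥ {order H}) (layer a Y) ⟩
    ∣ Subset.⊥ {order H} ∣ + ∣ layer a Y ∣ ≡⟨ cong₂ _+_ (∣⊥∣≡0 (order H)) (∣layer∣ a Y) ⟩
    ∣ Y ∣                                  ∎
    where open ≡-Reasoning

  lookup-layer-same : ∀ (a : Fin m) Y k → lookup (layer a Y) (combine a k) ≡ lookup Y k
  lookup-layer-same {suc m} zero    Y k = lookup-++ˡ Y Subset.⊥ k
  lookup-layer-same {suc m} (suc a) Y k =
    trans (lookup-++ʳ (Subset.⊥ {order H}) (layer a Y) (combine a k)) (lookup-layer-same a Y k)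

  lookup-layer-other : ∀ (a b : Fin m) Y k → ¬ b ≡ a → lookup (layer a Y) (combine b k) ≡ false
  lookup-layer-other {suc m} zero    zero    Y k b≢a = ⊥-elim (b≢a refl)
  lookup-layer-other {suc m} zero    (suc b) Y k _   =
    trans (lookup-++ʳ Y Subset.⊥ (combine b k)) (lookup-replicate (combine b k) false)
  lookup-layer-other {suc m} (suc a) zero    Y k _   =
    trans (lookup-++ˡ (Subset.⊥ {order H}) (layer a Y) k) (lookup-replicate k false)
  lookup-layer-other {suc m} (suc a) (suc b) Y k b≢a =
    trans (lookup-++ʳ (Subset.⊥ {order H}) (layer a Y) (combine b k))
          (lookup-layer-other a b Y k (λ b≡a → b≢a (cong suc b≡a)))

  ∈-layer⁺ : ∀ (a : Fin m) {Y h} → h ∈ Y → combine a h ∈ layer a Y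
  ∈-layer⁺ a {Y} {h} h∈Y = lookup⇒[]= _ (layer a Y) (trans (lookup-layer-same a Y h) ([]=⇒lookup h∈Y))

  ∈-layer⁻ : ∀ (a b : Fin m) {Y h} → combine b h ∈ layer a Y → b ≡ a × h ∈ Y
  ∈-layer⁻ a b {Y} {h} bh∈ with b Fin.≟ a
  ... | yes refl = refl , lookup⇒[]= h Y (trans (sym (lookup-layer-same a Y h)) ([]=⇒lookup bh∈))
  ... | no  b≢a  with () ← trans (sym ([]=⇒lookup bh∈)) (lookup-layer-other a b Y h b≢a)

  slice : Fin m → Subset (m * order H) → Subset (order H)
  slice a X = tabulate (λ h → lookup X (combine a h))

  ∈-slice⁺ : ∀ (a : Fin m) {X h} → combine a h ∈ X → h ∈ slice a X
  ∈-slice⁺ a {X} {h} ah∈X =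
    lookup⇒[]= h (slice a X) (trans (lookup∘tabulate _ h) ([]=⇒lookup ah∈X))

  ∈-slice⁻ : ∀ (a : Fin m) {X h} → h ∈ slice a X → combine a h ∈ X
  ∈-slice⁻ a {X} {h} h∈slice =
    lookup⇒[]= _ X (trans (sym (lookup∘tabulate _ h)) ([]=⇒lookup h∈slice))

  P₃-avoiding-layer : ∀ (a : Fin m) Y → P₃-Avoiding H Y → P₃-Avoiding (K m ∘ₗ H) (layer a Y)
  P₃-avoiding-layer {m} a Y avoiding u x v u∈ x∈ P
    with combine-surjective {m} {order H} u | combine-surjective {m} {order H} x
       | combine-surjective {m} {order H} v
  ... | b , h , refl | c , y , refl | d , k , refl with ∈-layer⁻ a b u∈ | ∈-layer⁻ a c x∈
  ... | refl , h∈Y | refl , y∈Y with d Fin.≟ a | P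
  ... | yes refl | _               = avoiding h y k h∈Y y∈Y (InducedP₃-in-layer⁻ a P)
  ... | no  d≢a  | (_ , _ , _ , ¬hk) = ¬hk (Adj-different-layers h k (λ a≡d → d≢a (sym a≡d)))

  P₃-avoiding-slice : ∀ (a : Fin m) X → P₃-Avoiding (K m ∘ₗ H) X → P₃-Avoiding H (slice a X)
  P₃-avoiding-slice a X avoiding h y k h∈ y∈ P =
    avoiding (combine a h) (combine a y) (combine a k) (∈-slice⁻ a h∈) (∈-slice⁻ a y∈) (InducedP₃-in-layer a P)

  -- Two layers of a P₃-avoiding set would give combine a h – combine b k – combine a h′
  -- for a non-neighbour h′ of h.
  P₃-avoiding-one-layer : NoUniversal H → ∀ X → P₃-Avoiding (K m ∘ₗ H) X →
                          ∀ (a b : Fin m) h k → combine a h ∈ X → combine b k ∈ X → b ≡ a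
  P₃-avoiding-one-layer no-universal X avoiding a b h k ah∈X bk∈X with b Fin.≟ a
  ... | yes b≡a = b≡a
  ... | no  b≢a with non-neighbour H no-universal h
  ... | h′ , h′≢h , ¬hh′ = ⊥-elim (avoiding (combine a h) (combine b k) (combine a h′) ah∈X bk∈X
        (Adj-different-layers h k (λ a≡b → b≢a (sym a≡b)) , Adj-different-layers k h′ b≢a ,
         (λ e → h′≢h (sym (combine-injectiveʳ a h a h′ e))) ,
         (λ hh′ → ¬hh′ (trans (sym (adj-same-layer a h h′)) hh′))))

  ⊆-layer-slice : ∀ (a : Fin m) X → (∀ b k → combine b k ∈ X → b ≡ a) → X ⊆ layer a (slice a X)
  ⊆-layer-slice {m} a X in-layer-a {x} x∈X with combine-surjective {m} {order H} x
  ... | b , k , refl with in-layer-a b k x∈X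
  ... | refl = ∈-layer⁺ a (∈-slice⁺ a x∈X)

  H≼K∘H : P₃-Avoiding H ≼ P₃-Avoiding (K (suc m) ∘ₗ H)
  H≼K∘H {m} Y avoiding = layer a Y , P₃-avoiding-layer a Y avoiding , ≤-reflexive (sym (∣layer∣ a Y))
    where
    a : Fin (suc m)
    a = zero

  K∘H≼H : NoUniversal H → P₃-Avoiding (K m ∘ₗ H) ≼ P₃-Avoiding H
  K∘H≼H {m} no-universal X avoiding with any? (_∈? X)
  ... | no X-empty = Subset.⊥ , ∅-P₃-avoiding H , ≤-trans (p⊆q⇒∣p∣≤∣q∣ X⊆∅)
        (≤-reflexive (trans (∣⊥∣≡0 (m * order H)) (sym (∣⊥∣≡0 (order H)))))
    where
    X⊆∅ : X ⊆ Subset.⊥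
    X⊆∅ x∈X = ⊥-elim (X-empty (_ , x∈X))
  ... | yes (u , u∈X) with combine-surjective {m} {order H} u
  ... | a , h , refl = slice a X , P₃-avoiding-slice a X avoiding ,
        ≤-trans (p⊆q⇒∣p∣≤∣q∣ (⊆-layer-slice a X λ b k → P₃-avoiding-one-layer no-universal X avoiding a b h k u∈X))
                (≤-reflexive (∣layer∣ a (slice a X)))

open Lexicographic using (K∘-diameterAtMost2; H≼K∘H; K∘H≼H)

theorem5p7 : (m : ℕ) → 2 ≤ m → (H : Graph) → IsSimple H → Connected H →
    2 ≤ order H → NoUniversal H →
    (Diam H 2 → SameGpo (K m ∘ₗ H) H) ×
    (∀ d → Diam H d → 2 < d → SameGpo (K m ∘ₗ H) (K1+ H))
theorem5p7 (suc zero) (s≤s ())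
theorem5p7 (suc (suc m)) _ H (_ , loopless) connected 2≤n no-universal
  with maxOf-P₃-avoiding H
... | k , max-H = part-i , part-ii
  where

  gpo-K∘H : IsGpo (K (suc (suc m)) ∘ₗ H) k
  gpo-K∘H = gpo-from-P₃-avoiding _ (K∘-diameterAtMost2 H)
              (MaxOf-transfer (H≼K∘H H) (K∘H≼H H no-universal) max-H)

  part-i : Diam H 2 → SameGpo (K (suc (suc m)) ∘ₗ H) H
  part-i diam = k , gpo-K∘H , gpo-from-P₃-avoiding H (Diam2⇒DiameterAtMost2 H connected diam) max-H

  part-ii : ∀ d → Diam H d → 2 < d → SameGpo (K (suc (suc m)) ∘ₗ H) (K1+ H)
  part-ii _ _ _ = k , gpo-K∘H , gpo-from-P₃-avoiding (K1+ H) (K1+-diameterAtMost2 H)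
                    (MaxOf-transfer (H≼K1+H H) (K1+H≼H H loopless no-universal 2≤n) max-H)
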